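{- For all $k,h\in\mathbb{N}$: $\mathrm{TD}_0\mathrm{MW}_h=\mathrm{MW}_h$, but $\mathrm{TD}_k\mathrm{MW}_0\neq\mathrm{TD}_k$.
   Context: Graphs are finite and simple. Operations: $\circ,\bullet$ return the empty and the one-vertex graph; $\mathrm{Union}_t$ ($t\ge2$) is disjoint union; $\mathrm{Join}_t$ is disjoint union plus all edges between different arguments; $\mathrm{Inc}_{x,E_x}(G)=(V\cup\{x\},E\cup E_x)$ for $G=(V,E)$, $x\notin V$, $E_x\subseteq\{\{x,v\}\mid v\in V\}$; $\mathrm{Subst}_H(G_1,\dots,G_t)$ for $V(H)=\{v_1,\dots,v_t\}$ replaces each $v_i$ by a disjoint copy of $G_i$ and adds all edges between $V(G_i)$ and $V(G_j)$ whenever $\{v_i,v_j\}\in E(H)$. A graph has an algebraic expression over a set of operations if it is (up to renaming) the value of it; the empty graph corresponds to the empty expression. The nesting depth of an operation is the maximum number of expression-tree nodes labelled by it on a root-to-leaf path. $\mathrm{TD}_k$: graphs with an expression over $\{\circ,\mathrm{Union}\}\cup\{\mathrm{Inc}_{x,E_x}\}$ with $\mathrm{Inc}$ nesting depth at most $k$. $\mathrm{MW}_h$: graphs with an expression over $\{\bullet,\mathrm{Union},\mathrm{Join}\}\cup\{\mathrm{Subst}_H\mid|V(H)|\le h\}$. $\mathrm{TD}_k\mathrm{MW}_h$: graphs with an expression over $\{\circ,\bullet,\mathrm{Union},\mathrm{Join}\}\cup\{\mathrm{Inc}_{x,E_x}\}\cup\{\mathrm{Subst}_H\mid|V(H)|\le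 h\}$ with $\mathrm{Inc}$ nesting depth at most $k$. -}

module Defs where

open import Data.Nat using (ℕ; zero; suc; _≤_; _⊔_)
open import Data.Fin using (Fin; _≟_) renaming (zero to fz; suc to fs)
open import Data.Bool using (Bool; true; false)
open import Data.Empty using (⊥)
open import Data.Unit using (⊤)
open import Data.Maybe using (Maybe; just; nothing)
open import Data.Product using (Σ; _×_; _,_)
open import Data.Sum using (_⊎_)
open import Relation.Nullary using (yes; no)
open import Relation.Binary.PropositionalEquality using (_≡_; refl)
open import Function.Bundles using (_↔_; Inverse)

record Graph : Set where
  field
    n      : ℕ
    adj    : Fin n → Fin n → Bool
    sym    : ∀ i j → adj i j ≡ adj j i
    irrefl : ∀ i → adj i i ≡ false

-- The value of an expression: a graph on an arbitrary vertex type
-- (the vertex types produced below are always finite).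
record RawGraph : Set₁ where
  field
    V   : Set
    adj : V → V → Bool

sumG : (t : ℕ) → (Fin t → RawGraph) → (Fin t → Fin t → Bool) → RawGraph
sumG t F B = record { V = Σ (Fin t) (λ i → RawGraph.V (F i)) ; adj = A }
  where
  A : Σ (Fin t) (λ i → RawGraph.V (F i)) → Σ (Fin t) (λ i → RawGraph.V (F i)) → Bool
  A (i , u) (j , v) with i ≟ j
  ... | yes refl = RawGraph.adj (F i) u v
  ... | no _ = B i j

-- Inc_{x,E_x}: add a new vertex x (= nothing) adjacent to the vertices in E.
incG : (G : RawGraph) → (RawGraph.V G → Bool) → RawGraph
incG G E = record { V = Maybe (RawGraph.V G) ; adj = A }
  where
  A : Maybe (RawGraph.V G) → Maybe (RawGraph.V G) → Bool
  A nothing nothing = false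
  A nothing (just v) = E v
  A (just u) nothing = E u
  A (just u) (just v) = RawGraph.adj G u v

mutual
  data Expr : Set where
    ∘op     : Expr
    •op     : Expr
    unionOp : (t : ℕ) → 2 ≤ t → (Fin t → Expr) → Expr
    joinOp  : (t : ℕ) → 2 ≤ t → (Fin t → Expr) → Expr
    incOp   : (e : Expr) → (RawGraph.V (eval e) → Bool) → Expr
    substOp : (H : Graph) → (Fin (Graph.n H) → Expr) → Expr

  eval : Expr → RawGraph
  eval ∘op = record { V = ⊥ ; adj = λ () }
  eval •op = record { V = ⊤ ; adj = λ _ _ → false }
  eval (unionOp t _ f) = sumG t (λ i → eval (f i)) (λ _ _ → false)
  eval (joinOp t _ f) = sumG t (λ i → eval (f i)) (λ _ _ → true)
  eval (incOp e E) = incG (eval e) E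
  eval (substOp H f) = sumG (Graph.n H) (λ i → eval (f i)) (Graph.adj H)

maxF : (t : ℕ) → (Fin t → ℕ) → ℕ
maxF zero _ = 0
maxF (suc t) f = f fz ⊔ maxF t (λ i → f (fs i))

incDepth : Expr → ℕ
incDepth ∘op = 0
incDepth •op = 0
incDepth (unionOp t _ f) = maxF t (λ i → incDepth (f i))
incDepth (joinOp t _ f) = maxF t (λ i → incDepth (f i))
incDepth (incOp e _) = suc (incDepth e)
incDepth (substOp H f) = maxF (Graph.n H) (λ i → incDepth (f i))

data IsTDExpr : Expr → Set where
  td-∘     : IsTDExpr ∘op
  td-union : ∀ t p f → (∀ i → IsTDExpr (f i)) → IsTDExpr (unionOp t p f)
  td-inc   : ∀ e E → IsTDExpr e → IsTDExpr (incOp e E)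

data IsMWExpr (h : ℕ) : Expr → Set where
  mw-•     : IsMWExpr h •op
  mw-union : ∀ t p f → (∀ i → IsMWExpr h (f i)) → IsMWExpr h (unionOp t p f)
  mw-join  : ∀ t p f → (∀ i → IsMWExpr h (f i)) → IsMWExpr h (joinOp t p f)
  mw-subst : ∀ H f → Graph.n H ≤ h → (∀ i → IsMWExpr h (f i)) → IsMWExpr h (substOp H f)

data IsTDMWExpr (h : ℕ) : Expr → Set where
  x-∘     : IsTDMWExpr h ∘op
  x-•     : IsTDMWExpr h •op
  x-union : ∀ t p f → (∀ i → IsTDMWExpr h (f i)) → IsTDMWExpr h (unionOp t p f)
  x-join  : ∀ t p f → (∀ i → IsTDMWExpr h (f i)) → IsTDMWExpr h (joinOp t p f)
  x-inc   : ∀ e E → IsTDMWExpr h e → IsTDMWExpr h (incOp e E)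
  x-subst : ∀ H f → Graph.n H ≤ h → (∀ i → IsTDMWExpr h (f i)) → IsTDMWExpr h (substOp H f)

record _≅_ (R : RawGraph) (G : Graph) : Set where
  field
    bij      : RawGraph.V R ↔ Fin (Graph.n G)
    preserve : ∀ u v → RawGraph.adj R u v ≡ Graph.adj G (Inverse.to bij u) (Inverse.to bij v)

-- G has an expression among those satisfying P; the empty graph
-- corresponds to the empty expression.
HasExpr : (Expr → Set) → Graph → Set
HasExpr P G = (Graph.n G ≡ 0) ⊎ Σ Expr (λ e → P e × (eval e ≅ G))

TD : ℕ → Graph → Set
TD k = HasExpr (λ e → IsTDExpr e × incDepth e ≤ k)

MW : ℕ → Graph → Set
MW h = HasExpr (IsMWExpr h)

TDMW : ℕ → ℕ → Graph → Set
TDMW k h = HasExpr (λ e → IsTDMWExpr h e × incDepth e ≤ k)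

{-# OPTIONS --safe #-}
module Submission where

-- An Inc-free expression over the combined operations is already an MW_h
-- expression, except for ∘, which is the substitution into the graph with no
-- vertices. For the separation, the value of a TD expression of Inc depth k
-- has no clique of size k + 1: a Union keeps a clique inside one component,
-- and an Inc contributes at most its one new vertex. Yet the complete graph
-- on k + 1 vertices is a Join of single vertices.

open import Defs
open import Data.Nat using (ℕ; zero; suc; _≤_; _<_; z≤n; s≤s)
open import Data.Nat.Properties using (m≤m⊔n; m≤n⊔m; ≤-trans; ≤-reflexive; <-irrefl; <-≤-trans; n≮0; n<1+n)
open import Data.Fin using (Fin; punchIn) renaming (zero to fz; suc to fs)
open import Data.Fin.Properties using (_≟_; punchInᵢ≢i; punchIn-injective; any?)
open import Data.Bool using (Bool; true; false)
open import Data.Empty using (⊥-elim)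
open import Data.Unit using (tt)
open import Data.Maybe using (just; nothing)
open import Data.Product using (Σ; ∃; _×_; _,_; proj₁; proj₂)
open import Data.Sum using (inj₁; inj₂)
open import Function.Bundles using (_⇔_; _↔_; Inverse; Equivalence; mk⇔; mk↔ₛ′)
open import Function.Properties.Inverse using (↔-refl; ↔-trans)
open import Relation.Nullary using (¬_; yes; no)
open import Relation.Unary using (Decidable)
open import Relation.Binary.PropositionalEquality
  using (_≡_; _≢_; refl; sym; trans; cong; cong₂; subst; module ≡-Reasoning)

open RawGraph using (V)

maxF-zero : ∀ t (f : Fin t → ℕ) → (∀ i → f i ≡ 0) → maxF t f ≡ 0
maxF-zero zero    f f≡0 = refl
maxF-zero (suc t) f f≡0 rewrite f≡0 fz = maxF-zero t (λ i → f (fs i)) (λ i → f≡0 (fs i))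

≤maxF : ∀ t (f : Fin t → ℕ) i → f i ≤ maxF t f
≤maxF (suc t) f fz     = m≤m⊔n (f fz) _
≤maxF (suc t) f (fs i) = ≤-trans (≤maxF t (λ i → f (fs i)) i) (m≤n⊔m (f fz) _)

record _≃_ (R S : RawGraph) : Set where
  field
    bij      : V R ↔ V S
    preserve : ∀ u v → RawGraph.adj R u v ≡ RawGraph.adj S (Inverse.to bij u) (Inverse.to bij v)

≃-refl : ∀ {R} → R ≃ R
≃-refl = record { bij = ↔-refl ; preserve = λ _ _ → refl }

≃-≅-trans : ∀ {R S G} → R ≃ S → S ≅ G → R ≅ G
≃-≅-trans R≃S S≅G = record
  { bij      = ↔-trans (_≃_.bij R≃S) (_≅_.bij S≅G)
  ; preserve = λ u v → trans (_≃_.preserve R≃S u v) (_≅_.preserve S≅G _ _)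
  }

sumG-cong : ∀ t {F F′ : Fin t → RawGraph} B → (∀ i → F i ≃ F′ i) → sumG t F B ≃ sumG t F′ B
sumG-cong t {F} {F′} B F≃F′ = record
  { bij      = mk↔ₛ′ to from (λ { (i , v) → cong (i ,_) (Iso.strictlyInverseˡ i v) })
                             (λ { (i , v) → cong (i ,_) (Iso.strictlyInverseʳ i v) })
  ; preserve = preserve
  }
  where
  module Iso i = Inverse (_≃_.bij (F≃F′ i))
  to : V (sumG t F B) → V (sumG t F′ B)
  to (i , v) = i , Iso.to i v
  from : V (sumG t F′ B) → V (sumG t F B)
  from (i , v) = i , Iso.from i v
  preserve : ∀ u v → RawGraph.adj (sumG t F B) u v ≡ RawGraph.adj (sumG t F′ B) (to u) (to v)
  preserve (i , u) (j , v) with i ≟ j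
  ... | yes refl = _≃_.preserve (F≃F′ i) u v
  ... | no _     = refl

emptyGraph : Graph
emptyGraph = record { n = 0 ; adj = λ () ; sym = λ () ; irrefl = λ () }

substEmpty≃∘ : eval (substOp emptyGraph (λ ())) ≃ eval ∘op
substEmpty≃∘ = record
  { bij      = mk↔ₛ′ (λ { (() , _) }) (λ ()) (λ ()) (λ { (() , _) })
  ; preserve = λ { (() , _) }
  }

mutual
  incFree⇒MWExpr : ∀ {h e} → IsTDMWExpr h e → incDepth e ≤ 0 →
                   Σ Expr λ e′ → IsMWExpr h e′ × (eval e′ ≃ eval e)
  incFree⇒MWExpr x-∘ _ = substOp emptyGraph (λ ()) , mw-subst _ _ z≤n (λ ()) , substEmpty≃∘
  incFree⇒MWExpr x-• _ = •op , mw-• , ≃-refl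
  incFree⇒MWExpr (x-union t p f xs) d with incFree⇒MWExprs t f xs d
  ... | g , ms , g≃f = unionOp t p g , mw-union t p g ms , sumG-cong t _ g≃f
  incFree⇒MWExpr (x-join t p f xs) d with incFree⇒MWExprs t f xs d
  ... | g , ms , g≃f = joinOp t p g , mw-join t p g ms , sumG-cong t _ g≃f
  incFree⇒MWExpr (x-inc _ _ _) ()
  incFree⇒MWExpr (x-subst H f n≤h xs) d with incFree⇒MWExprs (Graph.n H) f xs d
  ... | g , ms , g≃f = substOp H g , mw-subst H g n≤h ms , sumG-cong (Graph.n H) _ g≃f

  incFree⇒MWExprs : ∀ {h} t (f : Fin t → Expr) → (∀ i → IsTDMWExpr h (f i)) →
                    maxF t (λ i → incDepth (f i)) ≤ 0 →
                    Σ (Fin t → Expr) λ g → (∀ i → IsMWExpr h (g i)) × (∀ i → eval (g i) ≃ eval (f i))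
  incFree⇒MWExprs t f xs d =
    (λ i → proj₁ (translated i)) , (λ i → proj₁ (proj₂ (translated i))) , (λ i → proj₂ (proj₂ (translated i)))
    where
    translated = λ i → incFree⇒MWExpr (xs i) (≤-trans (≤maxF t (λ i → incDepth (f i)) i) d)

MWExpr⇒TDMWExpr : ∀ {h e} → IsMWExpr h e → IsTDMWExpr h e
MWExpr⇒TDMWExpr mw-•                    = x-•
MWExpr⇒TDMWExpr (mw-union t p f ms)     = x-union t p f (λ i → MWExpr⇒TDMWExpr (ms i))
MWExpr⇒TDMWExpr (mw-join t p f ms)      = x-join t p f (λ i → MWExpr⇒TDMWExpr (ms i))
MWExpr⇒TDMWExpr (mw-subst H f n≤h ms)   = x-subst H f n≤h (λ i → MWExpr⇒TDMWExpr (ms i))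

MWExpr-incDepth : ∀ {h e} → IsMWExpr h e → incDepth e ≡ 0
MWExpr-incDepth mw-•                  = refl
MWExpr-incDepth (mw-union t p f ms)   = maxF-zero t _ (λ i → MWExpr-incDepth (ms i))
MWExpr-incDepth (mw-join t p f ms)    = maxF-zero t _ (λ i → MWExpr-incDepth (ms i))
MWExpr-incDepth (mw-subst H f _ ms)   = maxF-zero (Graph.n H) _ (λ i → MWExpr-incDepth (ms i))

MW⊆TDMW : ∀ k h G → MW h G → TDMW k h G
MW⊆TDMW k h G (inj₁ n≡0)          = inj₁ n≡0
MW⊆TDMW k h G (inj₂ (e , m , e≅G)) =
  inj₂ (e , (MWExpr⇒TDMWExpr m , ≤-trans (≤-reflexive (MWExpr-incDepth m)) z≤n) , e≅G)

TDMW₀⊆MW : ∀ h G → TDMW 0 h G → MW h G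
TDMW₀⊆MW h G (inj₁ n≡0)                = inj₁ n≡0
TDMW₀⊆MW h G (inj₂ (e , (x , d) , e≅G)) with incFree⇒MWExpr x d
... | e′ , m , e′≃e = inj₂ (e′ , m , ≃-≅-trans e′≃e e≅G)

IsClique : (R : RawGraph) (m : ℕ) → (Fin m → V R) → Set
IsClique R m c = ∀ i j → i ≢ j → RawGraph.adj R (c i) (c j) ≡ true

sumG-adj-within : ∀ t F B i u v → RawGraph.adj (sumG t F B) (i , u) (i , v) ≡ RawGraph.adj (F i) u v
sumG-adj-within t F B i u v with i ≟ i
... | yes refl = refl
... | no i≢i   = ⊥-elim (i≢i refl)

unionG-adj⇒sameComponent : ∀ t F p q → RawGraph.adj (sumG t F (λ _ _ → false)) p q ≡ true →
                           proj₁ p ≡ proj₁ q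
unionG-adj⇒sameComponent t F (i , u) (j , v) adj≡true with i ≟ j
... | yes i≡j = i≡j
... | no _    with () ← adj≡true

clique-unionG : ∀ t F m c → IsClique (sumG t F (λ _ _ → false)) (suc m) c →
                Σ (Fin t) λ i → Σ (Fin (suc m) → V (F i)) (IsClique (F i) (suc m))
clique-unionG t F m c clique = i₀ , c′ , clique′
  where
  i₀ = proj₁ (c fz)
  inComponent : ∀ j → proj₁ (c j) ≡ i₀
  inComponent fz     = refl
  inComponent (fs j) = sym (unionG-adj⇒sameComponent t F (c fz) (c (fs j)) (clique fz (fs j) λ ()))
  restrict : ∀ p → proj₁ p ≡ i₀ → V (F i₀)
  restrict (i , u) refl = u
  restrict-adj : ∀ p q (p∈ : proj₁ p ≡ i₀) (q∈ : proj₁ q ≡ i₀) →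
                 RawGraph.adj (sumG t F (λ _ _ → false)) p q ≡ RawGraph.adj (F i₀) (restrict p p∈) (restrict q q∈)
  restrict-adj (i , u) (i , v) refl refl = sumG-adj-within t F _ i u v
  c′ = λ j → restrict (c j) (inComponent j)
  clique′ : IsClique (F i₀) (suc m) c′
  clique′ a b a≢b = trans (sym (restrict-adj (c a) (c b) (inComponent a) (inComponent b))) (clique a b a≢b)

atMostOne⇒avoidable : ∀ {m} (P : Fin (suc m) → Set) → Decidable P → (∀ a b → P a → P b → a ≡ b) →
                  ∃ λ j → ∀ a → ¬ P (punchIn j a)
atMostOne⇒avoidable P P? unique with any? P?
... | yes (j , Pj) = j , λ a Pa → punchInᵢ≢i j a (unique _ _ Pa Pj)
... | no ¬∃P       = fz , λ a Pa → ¬∃P (_ , Pa)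

clique-incG : ∀ G E m c → IsClique (incG G E) (suc m) c → Σ (Fin m → V G) (IsClique G m)
clique-incG G E m c clique = c′ , clique′
  where
  isNew? : Decidable (λ j → c j ≡ nothing)
  isNew? j with c j
  ... | nothing = yes refl
  ... | just _  = no λ ()
  newVertex-irrefl : ∀ {x y} → x ≡ nothing → y ≡ nothing → RawGraph.adj (incG G E) x y ≡ false
  newVertex-irrefl refl refl = refl
  atMostOneNew : ∀ a b → c a ≡ nothing → c b ≡ nothing → a ≡ b
  atMostOneNew a b ca≡x cb≡x with a ≟ b
  ... | yes a≡b = a≡b
  ... | no a≢b  with () ← trans (sym (newVertex-irrefl ca≡x cb≡x)) (clique a b a≢b)
  skipped = atMostOne⇒avoidable _ isNew? atMostOneNew
  old : ∀ x → x ≢ nothing → V G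
  old (just u) _   = u
  old nothing  x≢x = ⊥-elim (x≢x refl)
  old-adj : ∀ x y (x≢ : x ≢ nothing) (y≢ : y ≢ nothing) →
            RawGraph.adj (incG G E) x y ≡ RawGraph.adj G (old x x≢) (old y y≢)
  old-adj (just u) (just v) _ _ = refl
  old-adj nothing  _ x≢ _ = ⊥-elim (x≢ refl)
  old-adj (just u) nothing _ y≢ = ⊥-elim (y≢ refl)
  j = proj₁ skipped
  c′ = λ a → old (c (punchIn j a)) (proj₂ skipped a)
  clique′ : IsClique G m c′
  clique′ a b a≢b = trans (sym (old-adj _ _ (proj₂ skipped a) (proj₂ skipped b)))
                          (clique _ _ (λ eq → a≢b (punchIn-injective j a b eq)))

clique≤incDepth : ∀ {e} → IsTDExpr e → ∀ m c → IsClique (eval e) m c → m ≤ incDepth e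
clique≤incDepth _ zero _ _ = z≤n
clique≤incDepth td-∘ (suc m) c _ with c fz
... | ()
clique≤incDepth (td-union t p f xs) (suc m) c clique with clique-unionG t _ m c clique
... | i , c′ , clique′ =
  ≤-trans (clique≤incDepth (xs i) (suc m) c′ clique′) (≤maxF t (λ i → incDepth (f i)) i)
clique≤incDepth (td-inc _ E x) (suc m) c clique with clique-incG _ E m c clique
... | c′ , clique′ = s≤s (clique≤incDepth x m c′ clique′)

IsComplete : Graph → Set
IsComplete G = ∀ i j → i ≢ j → Graph.adj G i j ≡ true

≅-clique : ∀ {R G} (R≅G : R ≅ G) → IsComplete G → IsClique R (Graph.n G) (Inverse.from (_≅_.bij R≅G))
≅-clique {R} {G} R≅G complete i j i≢j = begin
  RawGraph.adj R (from i) (from j)           ≡⟨ _≅_.preserve R≅G (from i) (from j) ⟩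
  Graph.adj G (to (from i)) (to (from j))    ≡⟨ cong₂ (Graph.adj G) (strictlyInverseˡ i) (strictlyInverseˡ j) ⟩
  Graph.adj G i j                            ≡⟨ complete i j i≢j ⟩
  true                                       ∎
  where
  open Inverse (_≅_.bij R≅G)
  open ≡-Reasoning

complete∉TD : ∀ k G → IsComplete G → k < Graph.n G → ¬ TD k G
complete∉TD k G complete k<n (inj₁ n≡0) = n≮0 (subst (k <_) n≡0 k<n)
complete∉TD k G complete k<n (inj₂ (e , (x , d) , e≅G)) =
  <-irrefl refl (<-≤-trans k<n (≤-trans (clique≤incDepth x _ _ (≅-clique e≅G complete)) d))

completeAdj : ∀ {n} → Fin n → Fin n → Bool
completeAdj i j with i ≟ j
... | yes _ = false
... | no _  = true

completeGraph : ℕ → Graph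
completeGraph n = record { n = n ; adj = completeAdj ; sym = symmetric ; irrefl = irreflexive }
  where
  symmetric : ∀ i j → completeAdj i j ≡ completeAdj j i
  symmetric i j with i ≟ j | j ≟ i
  ... | yes _   | yes _   = refl
  ... | no _    | no _    = refl
  ... | yes i≡j | no j≢i  = ⊥-elim (j≢i (sym i≡j))
  ... | no i≢j  | yes j≡i = ⊥-elim (i≢j (sym j≡i))
  irreflexive : ∀ i → completeAdj i i ≡ false
  irreflexive i with i ≟ i
  ... | yes _  = refl
  ... | no i≢i = ⊥-elim (i≢i refl)

completeGraph-isComplete : ∀ n → IsComplete (completeGraph n)
completeGraph-isComplete n i j i≢j with i ≟ j
... | yes i≡j = ⊥-elim (i≢j i≡j)
... | no _    = refl

completeGraph∈MW : ∀ n → MW 0 (completeGraph (suc n))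
completeGraph∈MW zero = inj₂ (•op , mw-• , record
  { bij      = mk↔ₛ′ (λ _ → fz) (λ _ → tt) (λ { fz → refl ; (fs ()) }) (λ _ → refl)
  ; preserve = λ _ _ → refl
  })
completeGraph∈MW (suc n) = inj₂ (joinOp (suc (suc n)) (s≤s (s≤s z≤n)) (λ _ → •op) ,
  mw-join _ _ _ (λ _ → mw-•) ,
  record { bij = mk↔ₛ′ proj₁ (λ i → i , tt) (λ _ → refl) (λ _ → refl) ; preserve = preserve })
  where
  preserve : ∀ u v → RawGraph.adj (eval (joinOp (suc (suc n)) (s≤s (s≤s z≤n)) (λ _ → •op))) u v
                   ≡ completeAdj (proj₁ u) (proj₁ v)
  preserve (i , tt) (j , tt) with i ≟ j
  ... | yes refl = refl
  ... | no _     = refl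

proposition2 : (k h : ℕ) →
    ((G : Graph) → TDMW 0 h G ⇔ MW h G) × ¬ ((G : Graph) → TDMW k 0 G ⇔ TD k G)
proposition2 k h = (λ G → mk⇔ (TDMW₀⊆MW h G) (MW⊆TDMW 0 h G)) , TDMW≢TD
  where
  TDMW≢TD : ¬ ((G : Graph) → TDMW k 0 G ⇔ TD k G)
  TDMW≢TD same = complete∉TD k (completeGraph (suc k)) (completeGraph-isComplete (suc k)) (n<1+n k)
    (Equivalence.to (same (completeGraph (suc k))) (MW⊆TDMW k 0 _ (completeGraph∈MW k)))
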